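{- Let $\mathcal{S}$ be the set of integers $n\geq0$ for which none of the following holds: (i) $n=2m$ for some positive integer $m$; (ii) $n=\alpha+\beta\cdot2^{s+2}$ for some positive integers $\alpha,\beta,s$ with $\alpha<2^s$; (iii) $n=4m+1$ for some positive integer $m$; (iv) $n=8m+3$ for some positive integer $m$; (v) the binary expansion of $n$ contains three consecutive digits $111$ (i.e., $n=\alpha+7\cdot2^t+\beta2^{t+3}$ for some integers $t,\alpha,\beta\geq0$ with $\alpha<2^t$). Then $\mathcal{S}=\{0,1,3\}$.
   Context: The conditions (i)–(v) are the hypotheses of the reduction rules $|H_8^{\nabla 2m}|=|H_8^{\nabla m}|$, $|H_8^{\nabla n}|=|H_8^{\nabla\alpha}||H_8^{\nabla\beta}|$, $|H_8^{\nabla(4m+1)}|=8|H_8^{\nabla m}|$, $|H_8^{\nabla(8m+3)}|=|H_8^{\nabla(2m+1)}|+40|H_8^{\nabla m}|$, and the three-consecutive-ones rule, for the symmetric powers of $H_8=\{1,\ldots,8\}$; only the purely arithmetic conditions are needed for the statement. -}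

module Defs where

open import Data.Nat using (ℕ; _+_; _*_; _^_; _<_; _≥_)
open import Data.Product using (∃-syntax; _×_)
open import Data.Sum using (_⊎_)
open import Relation.Binary.PropositionalEquality using (_≡_)
open import Relation.Nullary using (¬_)

CondI : ℕ → Set
CondI n = ∃[ m ] (m ≥ 1 × n ≡ 2 * m)

CondII : ℕ → Set
CondII n = ∃[ α ] ∃[ β ] ∃[ s ]
  (α ≥ 1 × β ≥ 1 × s ≥ 1 × α < 2 ^ s × n ≡ α + β * 2 ^ (s + 2))

CondIII : ℕ → Set
CondIII n = ∃[ m ] (m ≥ 1 × n ≡ 4 * m + 1)

CondIV : ℕ → Set
CondIV n = ∃[ m ] (m ≥ 1 × n ≡ 8 * m + 3)

CondV : ℕ → Set
CondV n = ∃[ t ] ∃[ α ] ∃[ β ]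
  (α < 2 ^ t × n ≡ α + 7 * 2 ^ t + β * 2 ^ (t + 3))

InS : ℕ → Set
InS n = ¬ (CondI n ⊎ CondII n ⊎ CondIII n ⊎ CondIV n ⊎ CondV n)

-- Only 0, 1 and 3 escape the residue classes modulo 8 that the conditions
-- cover: an even n ≥ 2 satisfies (i), n ≡ 1 (mod 4) with n ≥ 5 satisfies
-- (iii), n ≡ 3 (mod 8) with n ≥ 11 satisfies (iv), and n ≡ 7 (mod 8) has
-- binary expansion ending in 111, i.e. satisfies (v) with t = 0. Conversely 0, 1 and 3 are odd or zero, and each of
-- (ii)–(v) forces n ≥ 4.
module Submission where

open import Defs
open import Data.Nat using (ℕ; zero; suc; _+_; _*_; _^_; _≤_; z≤n; s≤s)
open import Data.Nat.Properties
open import Data.Nat.Tactic.RingSolver using (solve-∀)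
open import Data.Product using (_,_)
open import Data.Sum using (_⊎_; inj₁; inj₂)
open import Data.Empty using (⊥-elim)
open import Function.Bundles using (_⇔_; mk⇔)
open import Relation.Binary.PropositionalEquality using (_≡_; refl; sym; subst)
open import Relation.Nullary using (¬_)

Exceptional : ℕ → Set
Exceptional n = n ≡ 0 ⊎ n ≡ 1 ⊎ n ≡ 3

data EvenOrOdd : ℕ → Set where
  even : ∀ k → EvenOrOdd (2 * k)
  odd  : ∀ k → EvenOrOdd (1 + 2 * k)

evenOrOdd : ∀ n → EvenOrOdd n
evenOrOdd zero = even 0
evenOrOdd (suc n) with evenOrOdd n
... | even k = odd k
... | odd k  = subst EvenOrOdd (2[1+k]≡2+2k k) (even (suc k))
  where
  2[1+k]≡2+2k : ∀ k → 2 * (1 + k) ≡ 1 + (1 + 2 * k)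
  2[1+k]≡2+2k = solve-∀

exceptional⊎CondI⊎CondIII⊎CondIV⊎CondV :
  ∀ n → Exceptional n ⊎ CondI n ⊎ CondIII n ⊎ CondIV n ⊎ CondV n
exceptional⊎CondI⊎CondIII⊎CondIV⊎CondV n with evenOrOdd n
... | even zero    = inj₁ (inj₁ refl)
... | even (suc k) = inj₂ (inj₁ (suc k , s≤s z≤n , refl))
... | odd k with evenOrOdd k
...   | even zero    = inj₁ (inj₂ (inj₁ refl))
...   | even (suc j) = inj₂ (inj₂ (inj₁ (suc j , s≤s z≤n , ≡4m+1 (suc j))))
  where
  ≡4m+1 : ∀ j → 1 + 2 * (2 * j) ≡ 4 * j + 1
  ≡4m+1 = solve-∀
...   | odd j with evenOrOdd j
...     | even zero    = inj₁ (inj₂ (inj₂ refl))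
...     | even (suc i) = inj₂ (inj₂ (inj₂ (inj₁ (suc i , s≤s z≤n , ≡8m+3 (suc i)))))
  where
  ≡8m+3 : ∀ i → 1 + 2 * (1 + 2 * (2 * i)) ≡ 8 * i + 3
  ≡8m+3 = solve-∀
...     | odd i = inj₂ (inj₂ (inj₂ (inj₂ (0 , 0 , i , s≤s z≤n , ≡7+8β i))))
  where
  ≡7+8β : ∀ i → 1 + 2 * (1 + 2 * (1 + 2 * i)) ≡ 7 + i * 8
  ≡7+8β = solve-∀

exceptional⇒≤3 : ∀ {n} → Exceptional n → n ≤ 3
exceptional⇒≤3 (inj₁ refl)        = z≤n
exceptional⇒≤3 (inj₂ (inj₁ refl)) = s≤s z≤n
exceptional⇒≤3 (inj₂ (inj₂ refl)) = ≤-refl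

exceptional⇒¬CondI : ∀ {n} → Exceptional n → ¬ CondI n
exceptional⇒¬CondI (inj₁ refl)        (suc m , _ , ())
exceptional⇒¬CondI (inj₂ (inj₁ refl)) (m , _ , eq) = even≢odd m 0 (sym eq)
exceptional⇒¬CondI (inj₂ (inj₂ refl)) (m , _ , eq) = even≢odd m 1 (sym eq)

CondII⇒4≤n : ∀ {n} → CondII n → 4 ≤ n
CondII⇒4≤n (α , β@(suc _) , s , _ , _ , _ , _ , refl) = begin
  2 ^ 2                  ≤⟨ ^-monoʳ-≤ 2 (m≤n+m 2 s) ⟩
  2 ^ (s + 2)            ≤⟨ m≤n*m (2 ^ (s + 2)) β ⟩
  β * 2 ^ (s + 2)        ≤⟨ m≤n+m _ α ⟩
  α + β * 2 ^ (s + 2)    ∎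
  where open ≤-Reasoning

CondIII⇒4≤n : ∀ {n} → CondIII n → 4 ≤ n
CondIII⇒4≤n (m@(suc _) , _ , refl) = m≤n⇒m≤n+o 1 (m≤m*n 4 m)

CondIV⇒4≤n : ∀ {n} → CondIV n → 4 ≤ n
CondIV⇒4≤n (m@(suc _) , _ , refl) = m≤n⇒m≤n+o 3 (≤-trans (m≤m+n 4 4) (m≤m*n 8 m))

CondV⇒4≤n : ∀ {n} → CondV n → 4 ≤ n
CondV⇒4≤n (t , α , β , _ , refl) = begin
  4                                      ≤⟨ m≤n+m 4 3 ⟩
  7                                      ≤⟨ m≤m*n 7 (2 ^ t) {{m^n≢0 2 t}} ⟩
  7 * 2 ^ t                              ≤⟨ m≤n+m _ α ⟩
  α + 7 * 2 ^ t                          ≤⟨ m≤m+n _ _ ⟩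
  α + 7 * 2 ^ t + β * 2 ^ (t + 3)        ∎
  where open ≤-Reasoning

proposition14 : (n : ℕ) → InS n ⇔ (n ≡ 0 ⊎ n ≡ 1 ⊎ n ≡ 3)
proposition14 n = mk⇔ exceptional-if-in-S in-S-if-exceptional
  where
  exceptional-if-in-S : InS n → Exceptional n
  exceptional-if-in-S n∈S with exceptional⊎CondI⊎CondIII⊎CondIV⊎CondV n
  ... | inj₁ e                        = e
  ... | inj₂ (inj₁ i)                 = ⊥-elim (n∈S (inj₁ i))
  ... | inj₂ (inj₂ (inj₁ iii))        = ⊥-elim (n∈S (inj₂ (inj₂ (inj₁ iii))))
  ... | inj₂ (inj₂ (inj₂ (inj₁ iv)))  = ⊥-elim (n∈S (inj₂ (inj₂ (inj₂ (inj₁ iv)))))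
  ... | inj₂ (inj₂ (inj₂ (inj₂ v)))   = ⊥-elim (n∈S (inj₂ (inj₂ (inj₂ (inj₂ v)))))

  in-S-if-exceptional : Exceptional n → InS n
  in-S-if-exceptional e (inj₁ i) = exceptional⇒¬CondI e i
  in-S-if-exceptional e (inj₂ c) = <⇒≱ (s≤s (exceptional⇒≤3 e)) (≥4 c)
    where
    ≥4 : CondII n ⊎ CondIII n ⊎ CondIV n ⊎ CondV n → 4 ≤ n
    ≥4 (inj₁ ii)                = CondII⇒4≤n ii
    ≥4 (inj₂ (inj₁ iii))        = CondIII⇒4≤n iii
    ≥4 (inj₂ (inj₂ (inj₁ iv)))  = CondIV⇒4≤n iv
    ≥4 (inj₂ (inj₂ (inj₂ v)))   = CondV⇒4≤n v
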